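{- For every closed $\lambda\Omega^+$ term $M$ and every proper normal form $K$: $\vdash_{\lambda\Omega^+}M=K$ if and only if $\vdash_{\lambda\Omega}\widetilde{M}=K$.
   Context: Simple types are built from a ground type $o$ with $\to$; a type $\sigma_1\to\cdots\to\sigma_n\to o$ is $n$-ary. The $\lambda\Omega^+$-calculus is the typed (Church-style) $\lambda\beta\eta$-calculus extended with constants $\Omega_\sigma:\sigma$ for every type $\sigma$, with no additional conversion rules; the $\lambda\Omega$-calculus is the subsystem with only $\Omega=\Omega_o$. A proper normal form is a long $\beta\eta$-normal form containing no constant $\Omega_\sigma$. For $n$-ary $\sigma$ let $\widetilde{\Omega}_\sigma=\lambda x_1\ldots x_n.\Omega$; for a $\lambda\Omega^+$ term $M$, $\widetilde{M}$ is obtained by replacing every $\Omega_\sigma$ in $M$ by $\widetilde{\Omega}_\sigma$. -}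

module Defs where

open import Data.Unit using (⊤; tt)
open import Data.List using (List; []; _∷_)
open import Relation.Binary.PropositionalEquality using (_≡_; refl)

infixr 7 _⇒_
data Ty : Set where
  o   : Ty
  _⇒_ : Ty → Ty → Ty

Ctx : Set
Ctx = List Ty

infix 4 _∋_
data _∋_ : Ctx → Ty → Set where
  here  : ∀ {Γ σ} → (σ ∷ Γ) ∋ σ
  there : ∀ {Γ σ τ} → Γ ∋ σ → (τ ∷ Γ) ∋ σ

-- Church-style typed terms (de Bruijn), parameterised by the family C of
-- types at which a constant Ω is available:  con c : σ  for c : C σ.
data Tm (C : Ty → Set) (Γ : Ctx) : Ty → Set where
  var : ∀ {σ} → Γ ∋ σ → Tm C Γ σ
  lam : ∀ {σ τ} → Tm C (σ ∷ Γ) τ → Tm C Γ (σ ⇒ τ)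
  app : ∀ {σ τ} → Tm C Γ (σ ⇒ τ) → Tm C Γ σ → Tm C Γ τ
  con : ∀ {σ} → C σ → Tm C Γ σ

ConstΩ⁺ : Ty → Set
ConstΩ⁺ _ = ⊤

ConstΩ : Ty → Set
ConstΩ σ = σ ≡ o

TmΩ⁺ : Ctx → Ty → Set
TmΩ⁺ = Tm ConstΩ⁺

TmΩ : Ctx → Ty → Set
TmΩ = Tm ConstΩ

Ω⁺ : ∀ {Γ} (σ : Ty) → TmΩ⁺ Γ σ
Ω⁺ σ = con tt

Ω : ∀ {Γ} → TmΩ Γ o
Ω = con refl

Ren : Ctx → Ctx → Set
Ren Γ Δ = ∀ {σ} → Γ ∋ σ → Δ ∋ σ

extR : ∀ {Γ Δ τ} → Ren Γ Δ → Ren (τ ∷ Γ) (τ ∷ Δ)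
extR ρ here      = here
extR ρ (there x) = there (ρ x)

rename : ∀ {C Γ Δ σ} → Ren Γ Δ → Tm C Γ σ → Tm C Δ σ
rename ρ (var x)   = var (ρ x)
rename ρ (lam M)   = lam (rename (extR ρ) M)
rename ρ (app M N) = app (rename ρ M) (rename ρ N)
rename ρ (con c)   = con c

weaken : ∀ {C Γ σ τ} → Tm C Γ σ → Tm C (τ ∷ Γ) σ
weaken = rename there

Sub : (Ty → Set) → Ctx → Ctx → Set
Sub C Γ Δ = ∀ {σ} → Γ ∋ σ → Tm C Δ σ

extS : ∀ {C Γ Δ τ} → Sub C Γ Δ → Sub C (τ ∷ Γ) (τ ∷ Δ)
extS s here      = var here
extS s (there x) = weaken (s x)

subst : ∀ {C Γ Δ σ} → Sub C Γ Δ → Tm C Γ σ → Tm C Δ σ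
subst s (var x)   = s x
subst s (lam M)   = lam (subst (extS s) M)
subst s (app M N) = app (subst s M) (subst s N)
subst s (con c)   = con c

_[_] : ∀ {C Γ σ τ} → Tm C (σ ∷ Γ) τ → Tm C Γ σ → Tm C Γ τ
_[_] {C} {Γ} {σ} M N = subst s M
  where
    s : Sub C (σ ∷ Γ) Γ
    s here      = N
    s (there x) = var x

infix 4 _⊢_≈_
data _⊢_≈_ (C : Ty → Set) {Γ : Ctx} : ∀ {σ} → Tm C Γ σ → Tm C Γ σ → Set where
  ≈refl  : ∀ {σ} {M : Tm C Γ σ} → C ⊢ M ≈ M
  ≈sym   : ∀ {σ} {M N : Tm C Γ σ} → C ⊢ M ≈ N → C ⊢ N ≈ M
  ≈trans : ∀ {σ} {M N P : Tm C Γ σ} → C ⊢ M ≈ N → C ⊢ N ≈ P → C ⊢ M ≈ P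
  ≈lam   : ∀ {σ τ} {M N : Tm C (σ ∷ Γ) τ} → C ⊢ M ≈ N → C ⊢ lam M ≈ lam N
  ≈app   : ∀ {σ τ} {M M′ : Tm C Γ (σ ⇒ τ)} {N N′ : Tm C Γ σ} →
           C ⊢ M ≈ M′ → C ⊢ N ≈ N′ → C ⊢ app M N ≈ app M′ N′
  ≈β     : ∀ {σ τ} (M : Tm C (σ ∷ Γ) τ) (N : Tm C Γ σ) →
           C ⊢ app (lam M) N ≈ M [ N ]
  ≈η     : ∀ {σ τ} (M : Tm C Γ (σ ⇒ τ)) →
           C ⊢ lam (app (weaken M) (var here)) ≈ M

-- Long βη-normal forms (constants may occur as heads of neutral terms)
data Nf {C : Ty → Set} {Γ : Ctx} : ∀ {σ} → Tm C Γ σ → Set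
data Ne {C : Ty → Set} {Γ : Ctx} : ∀ {σ} → Tm C Γ σ → Set

data Nf {C} {Γ} where
  nf-lam : ∀ {σ τ} {M : Tm C (σ ∷ Γ) τ} → Nf M → Nf (lam M)
  nf-ne  : {M : Tm C Γ o} → Ne M → Nf M

data Ne {C} {Γ} where
  ne-var : ∀ {σ} (x : Γ ∋ σ) → Ne (var {C} x)
  ne-con : ∀ {σ} (c : C σ) → Ne (con {C} {Γ} c)
  ne-app : ∀ {σ τ} {M : Tm C Γ (σ ⇒ τ)} {N : Tm C Γ σ} → Ne M → Nf N → Ne (app M N)

data NoΩ {C : Ty → Set} {Γ : Ctx} : ∀ {σ} → Tm C Γ σ → Set where
  noΩ-var : ∀ {σ} (x : Γ ∋ σ) → NoΩ (var {C} x)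
  noΩ-lam : ∀ {σ τ} {M : Tm C (σ ∷ Γ) τ} → NoΩ M → NoΩ (lam M)
  noΩ-app : ∀ {σ τ} {M : Tm C Γ (σ ⇒ τ)} {N : Tm C Γ σ} → NoΩ M → NoΩ N → NoΩ (app M N)

ProperNf : ∀ {C Γ σ} → Tm C Γ σ → Set
ProperNf K = Nf K × NoΩ K
  where open import Data.Product using (_×_)

Ω̃ : ∀ {Γ} (σ : Ty) → TmΩ Γ σ
Ω̃ o       = Ω
Ω̃ (σ ⇒ τ) = lam (Ω̃ τ)

tilde : ∀ {Γ σ} → TmΩ⁺ Γ σ → TmΩ Γ σ
tilde (var x)   = var x
tilde (lam M)   = lam (tilde M)
tilde (app M N) = app (tilde M) (tilde N)
tilde {σ = σ} (con _) = Ω̃ σ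

-- Replacing Ω_σ by Ω̃_σ commutes with renaming and substitution, so it maps
-- every conversion of λΩ⁺ to a conversion of λΩ.  Conversely, normalise M to
-- a long normal form N of λΩ⁺; then ~N = ~K in λΩ, and it remains to see
-- that this forces N = K.  Interpret λΩ in a set model whose ground type
-- consists of raw terms indexed by a de Bruijn level, with Ω absorbing
-- application.  Reading back the value of ~N yields N printed with every
-- Ω_σ-headed neutral subterm collapsed to Ω, and this printing is injective
-- on normal forms as soon as one of the two compared forms is Ω-free.
module Submission where

open import Defs
open import Data.List using ([]; _∷_; length)
open import Data.Product using (Σ; ∃; _×_; _,_)
open import Data.Empty using (⊥-elim)
open import Data.Nat using (ℕ; zero; suc; _<_; s≤s; z≤n)
open import Data.Nat.Properties using (<-irrefl; m<n⇒m<1+n; n<1+n; suc-injective)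
open import Relation.Binary.PropositionalEquality as ≡ using (_≡_; _≢_; refl; sym; trans; cong; cong₂)

module _ {C : Ty → Set} where

  infixl 5 _▸_
  _▸_ : ∀ {Γ Δ σ} → Sub C Γ Δ → Tm C Δ σ → Sub C (σ ∷ Γ) Δ
  (s ▸ N) here      = N
  (s ▸ N) (there x) = s x

  extR-cong : ∀ {Γ Δ τ} {ρ ρ′ : Ren Γ Δ} → (∀ {σ} (x : Γ ∋ σ) → ρ x ≡ ρ′ x) →
              ∀ {σ} (x : (τ ∷ Γ) ∋ σ) → extR ρ x ≡ extR ρ′ x
  extR-cong h here      = refl
  extR-cong h (there x) = cong there (h x)

  rename-cong : ∀ {Γ Δ σ} {ρ ρ′ : Ren Γ Δ} → (∀ {σ} (x : Γ ∋ σ) → ρ x ≡ ρ′ x) →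
                (M : Tm C Γ σ) → rename ρ M ≡ rename ρ′ M
  rename-cong h (var x)   = cong var (h x)
  rename-cong h (lam M)   = cong lam (rename-cong (extR-cong h) M)
  rename-cong h (app M N) = cong₂ app (rename-cong h M) (rename-cong h N)
  rename-cong h (con c)   = refl

  rename-id : ∀ {Γ σ} (M : Tm C Γ σ) → rename (λ x → x) M ≡ M
  rename-id (var x)   = refl
  rename-id (lam M)   =
    cong lam (trans (rename-cong (λ { here → refl ; (there x) → refl }) M) (rename-id M))
  rename-id (app M N) = cong₂ app (rename-id M) (rename-id N)
  rename-id (con c)   = refl

  rename-∘ : ∀ {Γ Δ Θ σ} (ρ : Ren Γ Δ) (ρ′ : Ren Δ Θ) (M : Tm C Γ σ) →
             rename ρ′ (rename ρ M) ≡ rename (λ x → ρ′ (ρ x)) M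
  rename-∘ ρ ρ′ (var x)   = refl
  rename-∘ ρ ρ′ (lam M)   = cong lam (trans (rename-∘ (extR ρ) (extR ρ′) M)
                                        (rename-cong (λ { here → refl ; (there x) → refl }) M))
  rename-∘ ρ ρ′ (app M N) = cong₂ app (rename-∘ ρ ρ′ M) (rename-∘ ρ ρ′ N)
  rename-∘ ρ ρ′ (con c)   = refl

  extS-cong : ∀ {Γ Δ τ} {s s′ : Sub C Γ Δ} → (∀ {σ} (x : Γ ∋ σ) → s x ≡ s′ x) →
              ∀ {σ} (x : (τ ∷ Γ) ∋ σ) → extS s x ≡ extS s′ x
  extS-cong h here      = refl
  extS-cong h (there x) = cong weaken (h x)

  subst-cong : ∀ {Γ Δ σ} {s s′ : Sub C Γ Δ} → (∀ {σ} (x : Γ ∋ σ) → s x ≡ s′ x) →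
               (M : Tm C Γ σ) → subst s M ≡ subst s′ M
  subst-cong h (var x)   = h x
  subst-cong h (lam M)   = cong lam (subst-cong (extS-cong h) M)
  subst-cong h (app M N) = cong₂ app (subst-cong h M) (subst-cong h N)
  subst-cong h (con c)   = refl

  subst-id : ∀ {Γ σ} (M : Tm C Γ σ) → subst var M ≡ M
  subst-id (var x)   = refl
  subst-id (lam M)   =
    cong lam (trans (subst-cong (λ { here → refl ; (there x) → refl }) M) (subst-id M))
  subst-id (app M N) = cong₂ app (subst-id M) (subst-id N)
  subst-id (con c)   = refl

  rename-subst : ∀ {Γ Δ Θ σ} (s : Sub C Γ Δ) (ρ : Ren Δ Θ) (M : Tm C Γ σ) →
                 rename ρ (subst s M) ≡ subst (λ x → rename ρ (s x)) M
  rename-subst s ρ (var x)   = refl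
  rename-subst s ρ (lam M)   = cong lam (trans (rename-subst (extS s) (extR ρ) M)
    (subst-cong (λ { here → refl
                   ; (there x) → trans (rename-∘ there (extR ρ) (s x))
                                       (sym (rename-∘ ρ there (s x))) }) M))
  rename-subst s ρ (app M N) = cong₂ app (rename-subst s ρ M) (rename-subst s ρ N)
  rename-subst s ρ (con c)   = refl

  subst-rename : ∀ {Γ Δ Θ σ} (ρ : Ren Γ Δ) (s : Sub C Δ Θ) (M : Tm C Γ σ) →
                 subst s (rename ρ M) ≡ subst (λ x → s (ρ x)) M
  subst-rename ρ s (var x)   = refl
  subst-rename ρ s (lam M)   = cong lam (trans (subst-rename (extR ρ) (extS s) M)
                                          (subst-cong (λ { here → refl ; (there x) → refl }) M))
  subst-rename ρ s (app M N) = cong₂ app (subst-rename ρ s M) (subst-rename ρ s N)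
  subst-rename ρ s (con c)   = refl

  subst-∘ : ∀ {Γ Δ Θ σ} (s : Sub C Γ Δ) (s′ : Sub C Δ Θ) (M : Tm C Γ σ) →
            subst s′ (subst s M) ≡ subst (λ x → subst s′ (s x)) M
  subst-∘ s s′ (var x)   = refl
  subst-∘ s s′ (lam M)   = cong lam (trans (subst-∘ (extS s) (extS s′) M)
    (subst-cong (λ { here → refl
                   ; (there x) → trans (subst-rename there (extS s′) (s x))
                                       (sym (rename-subst s′ there (s x))) }) M))
  subst-∘ s s′ (app M N) = cong₂ app (subst-∘ s s′ M) (subst-∘ s s′ N)
  subst-∘ s s′ (con c)   = refl

  rename-as-subst : ∀ {Γ Δ σ} (ρ : Ren Γ Δ) (M : Tm C Γ σ) →
                    rename ρ M ≡ subst (λ x → var (ρ x)) M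
  rename-as-subst ρ M = trans (sym (subst-id (rename ρ M))) (subst-rename ρ var M)

  []-as-subst : ∀ {Γ σ τ} (M : Tm C (σ ∷ Γ) τ) (N : Tm C Γ σ) → M [ N ] ≡ subst (var ▸ N) M
  []-as-subst M N = subst-cong (λ { here → refl ; (there x) → refl }) M

  rename-[] : ∀ {Γ Δ σ τ} (ρ : Ren Γ Δ) (M : Tm C (σ ∷ Γ) τ) (N : Tm C Γ σ) →
              rename ρ (M [ N ]) ≡ rename (extR ρ) M [ rename ρ N ]
  rename-[] ρ M N = begin
    rename ρ (M [ N ])                             ≡⟨ cong (rename ρ) ([]-as-subst M N) ⟩
    rename ρ (subst (var ▸ N) M)                   ≡⟨ rename-subst (var ▸ N) ρ M ⟩
    subst (λ x → rename ρ ((var ▸ N) x)) M         ≡⟨ subst-cong (λ { here → refl ; (there x) → refl }) M ⟩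
    subst (λ x → (var ▸ rename ρ N) (extR ρ x)) M  ≡⟨ sym (subst-rename (extR ρ) (var ▸ rename ρ N) M) ⟩
    subst (var ▸ rename ρ N) (rename (extR ρ) M)   ≡⟨ sym ([]-as-subst (rename (extR ρ) M) (rename ρ N)) ⟩
    rename (extR ρ) M [ rename ρ N ]               ∎
    where open ≡.≡-Reasoning

  subst-extS-[] : ∀ {Γ Δ Θ σ τ} (s : Sub C Γ Δ) (ρ : Ren Δ Θ) (M : Tm C (σ ∷ Γ) τ) (A : Tm C Θ σ) →
                  rename (extR ρ) (subst (extS s) M) [ A ] ≡ subst ((λ x → rename ρ (s x)) ▸ A) M
  subst-extS-[] s ρ M A = begin
    rename (extR ρ) (subst (extS s) M) [ A ]
      ≡⟨ []-as-subst (rename (extR ρ) (subst (extS s) M)) A ⟩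
    subst (var ▸ A) (rename (extR ρ) (subst (extS s) M))
      ≡⟨ subst-rename (extR ρ) (var ▸ A) (subst (extS s) M) ⟩
    subst (λ x → (var ▸ A) (extR ρ x)) (subst (extS s) M)
      ≡⟨ subst-∘ (extS s) _ M ⟩
    subst (λ x → subst (λ y → (var ▸ A) (extR ρ y)) (extS s x)) M
      ≡⟨ subst-cong (λ { here → refl
                       ; (there x) → trans (subst-rename there _ (s x))
                                           (sym (rename-as-subst ρ (s x))) }) M ⟩
    subst ((λ x → rename ρ (s x)) ▸ A) M ∎
    where open ≡.≡-Reasoning

  ≡⇒≈ : ∀ {Γ σ} {M N : Tm C Γ σ} → M ≡ N → C ⊢ M ≈ N
  ≡⇒≈ refl = ≈refl

  ≈-rename : ∀ {Γ Δ σ} (ρ : Ren Γ Δ) {M N : Tm C Γ σ} → C ⊢ M ≈ N → C ⊢ rename ρ M ≈ rename ρ N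
  ≈-rename ρ ≈refl        = ≈refl
  ≈-rename ρ (≈sym p)     = ≈sym (≈-rename ρ p)
  ≈-rename ρ (≈trans p q) = ≈trans (≈-rename ρ p) (≈-rename ρ q)
  ≈-rename ρ (≈lam p)     = ≈lam (≈-rename (extR ρ) p)
  ≈-rename ρ (≈app p q)   = ≈app (≈-rename ρ p) (≈-rename ρ q)
  ≈-rename ρ (≈β M N)     =
    ≈trans (≈β (rename (extR ρ) M) (rename ρ N)) (≡⇒≈ (sym (rename-[] ρ M N)))
  ≈-rename ρ (≈η M)       = ≈trans
    (≡⇒≈ (cong (λ X → lam (app X (var here)))
               (trans (rename-∘ there (extR ρ) M) (sym (rename-∘ ρ there M)))))
    (≈η (rename ρ M))

  Nf-rename : ∀ {Γ Δ σ} (ρ : Ren Γ Δ) {M : Tm C Γ σ} → Nf M → Nf (rename ρ M)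
  Ne-rename : ∀ {Γ Δ σ} (ρ : Ren Γ Δ) {M : Tm C Γ σ} → Ne M → Ne (rename ρ M)
  Nf-rename ρ (nf-lam n)   = nf-lam (Nf-rename (extR ρ) n)
  Nf-rename ρ (nf-ne n)    = nf-ne (Ne-rename ρ n)
  Ne-rename ρ (ne-var x)   = ne-var (ρ x)
  Ne-rename ρ (ne-con c)   = ne-con c
  Ne-rename ρ (ne-app n m) = ne-app (Ne-rename ρ n) (Nf-rename ρ m)

-- Weak normalisation

module _ {C : Ty → Set} where

  HasNf : ∀ {Γ σ} → Tm C Γ σ → Set
  HasNf {Γ} {σ} M = Σ (Tm C Γ σ) λ N → Nf N × C ⊢ M ≈ N

  Red : ∀ {Γ} σ → Tm C Γ σ → Set
  Red o M = HasNf M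
  Red {Γ} (σ ⇒ τ) M = ∀ {Δ} (ρ : Ren Γ Δ) (A : Tm C Δ σ) → Red σ A → Red τ (app (rename ρ M) A)

  Red-resp-≈ : ∀ {Γ} σ {M M′ : Tm C Γ σ} → C ⊢ M ≈ M′ → Red σ M → Red σ M′
  Red-resp-≈ o p (N , n , q) = N , n , ≈trans (≈sym p) q
  Red-resp-≈ (σ ⇒ τ) p r ρ A a = Red-resp-≈ τ (≈app (≈-rename ρ p) ≈refl) (r ρ A a)

  Red-rename : ∀ {Γ Δ} σ (ρ : Ren Γ Δ) {M : Tm C Γ σ} → Red σ M → Red σ (rename ρ M)
  Red-rename o ρ (N , n , q) = rename ρ N , Nf-rename ρ n , ≈-rename ρ q
  Red-rename (σ ⇒ τ) ρ {M} r ρ′ A a =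
    Red-resp-≈ τ (≈app (≡⇒≈ (sym (rename-∘ ρ ρ′ M))) ≈refl) (r (λ x → ρ′ (ρ x)) A a)

  reflect : ∀ {Γ} σ {M N : Tm C Γ σ} → Ne N → C ⊢ M ≈ N → Red σ M
  reify   : ∀ {Γ} σ {M : Tm C Γ σ} → Red σ M → HasNf M
  reflect o n p = _ , nf-ne n , p
  reflect (σ ⇒ τ) n p ρ A a with reify σ a
  ... | A′ , nA , q = reflect τ (ne-app (Ne-rename ρ n) nA) (≈app (≈-rename ρ p) q)
  reify o r = r
  reify (σ ⇒ τ) {M} r with reify τ (r there (var here) (reflect σ (ne-var here) ≈refl))
  ... | B , nB , q = lam B , nf-lam nB , ≈trans (≈sym (≈η M)) (≈lam q)

  fundamental : ∀ {Γ Δ σ} (M : Tm C Γ σ) (s : Sub C Γ Δ) → (∀ {τ} (x : Γ ∋ τ) → Red τ (s x)) →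
                Red σ (subst s M)
  fundamental (var x) s h = h x
  fundamental (con c) s h = reflect _ (ne-con c) ≈refl
  fundamental (app M N) s h =
    Red-resp-≈ _ (≈app (≡⇒≈ (rename-id (subst s M))) ≈refl)
                 (fundamental M s h (λ x → x) (subst s N) (fundamental N s h))
  fundamental {σ = σ ⇒ τ} (lam M) s h ρ A a =
    Red-resp-≈ τ (≈sym (≈trans (≈β (rename (extR ρ) (subst (extS s) M)) A)
                               (≡⇒≈ (subst-extS-[] s ρ M A))))
                 (fundamental M _ h′)
    where
      h′ : ∀ {τ} (x : (σ ∷ _) ∋ τ) → Red τ (((λ y → rename ρ (s y)) ▸ A) x)
      h′ here      = a
      h′ (there x) = Red-rename _ ρ (h x)

  normalise : ∀ {Γ σ} (M : Tm C Γ σ) → HasNf M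
  normalise M = reify _ (Red-resp-≈ _ (≡⇒≈ (subst-id M))
                                      (fundamental M var (λ x → reflect _ (ne-var x) ≈refl)))

rename-Ω̃ : ∀ {Γ Δ} σ (ρ : Ren Γ Δ) → rename ρ (Ω̃ σ) ≡ Ω̃ σ
rename-Ω̃ o       ρ = refl
rename-Ω̃ (σ ⇒ τ) ρ = cong lam (rename-Ω̃ τ (extR ρ))

subst-Ω̃ : ∀ {Γ Δ} σ (s : Sub ConstΩ Γ Δ) → subst s (Ω̃ σ) ≡ Ω̃ σ
subst-Ω̃ o       s = refl
subst-Ω̃ (σ ⇒ τ) s = cong lam (subst-Ω̃ τ (extS s))

tilde-rename : ∀ {Γ Δ σ} (ρ : Ren Γ Δ) (M : TmΩ⁺ Γ σ) → tilde (rename ρ M) ≡ rename ρ (tilde M)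
tilde-rename ρ (var x)   = refl
tilde-rename ρ (lam M)   = cong lam (tilde-rename (extR ρ) M)
tilde-rename ρ (app M N) = cong₂ app (tilde-rename ρ M) (tilde-rename ρ N)
tilde-rename ρ (con c)   = sym (rename-Ω̃ _ ρ)

tilde-subst : ∀ {Γ Δ σ} (s : Sub ConstΩ⁺ Γ Δ) (M : TmΩ⁺ Γ σ) →
              tilde (subst s M) ≡ subst (λ x → tilde (s x)) (tilde M)
tilde-subst s (var x)   = refl
tilde-subst s (lam M)   = cong lam (trans (tilde-subst (extS s) M)
  (subst-cong (λ { here → refl ; (there x) → tilde-rename there (s x) }) (tilde M)))
tilde-subst s (app M N) = cong₂ app (tilde-subst s M) (tilde-subst s N)
tilde-subst s (con c)   = sym (subst-Ω̃ _ _)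

tilde-[] : ∀ {Γ σ τ} (M : TmΩ⁺ (σ ∷ Γ) τ) (N : TmΩ⁺ Γ σ) → tilde (M [ N ]) ≡ tilde M [ tilde N ]
tilde-[] M N = begin
  tilde (M [ N ])                               ≡⟨ cong tilde ([]-as-subst M N) ⟩
  tilde (subst (var ▸ N) M)                     ≡⟨ tilde-subst (var ▸ N) M ⟩
  subst (λ x → tilde ((var ▸ N) x)) (tilde M)   ≡⟨ subst-cong (λ { here → refl ; (there x) → refl }) (tilde M) ⟩
  subst (var ▸ tilde N) (tilde M)               ≡⟨ sym ([]-as-subst (tilde M) (tilde N)) ⟩
  tilde M [ tilde N ]                           ∎
  where open ≡.≡-Reasoning

tilde-≈ : ∀ {Γ σ} {M N : TmΩ⁺ Γ σ} → ConstΩ⁺ ⊢ M ≈ N → ConstΩ ⊢ tilde M ≈ tilde N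
tilde-≈ ≈refl        = ≈refl
tilde-≈ (≈sym p)     = ≈sym (tilde-≈ p)
tilde-≈ (≈trans p q) = ≈trans (tilde-≈ p) (tilde-≈ q)
tilde-≈ (≈lam p)     = ≈lam (tilde-≈ p)
tilde-≈ (≈app p q)   = ≈app (tilde-≈ p) (tilde-≈ q)
tilde-≈ (≈β M N)     = ≈trans (≈β (tilde M) (tilde N)) (≡⇒≈ (sym (tilde-[] M N)))
tilde-≈ (≈η M)       =
  ≈trans (≡⇒≈ (cong (λ X → lam (app X (var here))) (tilde-rename there M))) (≈η (tilde M))

-- A set model of λΩ

data Raw : Set where
  rvar : ℕ → Raw
  rlam : Raw → Raw
  rapp : Raw → Raw → Raw
  rΩ   : Raw

-- The ground type denotes raw terms parameterised by the first free de Bruijn level.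
⟦_⟧ : Ty → Set
⟦ o ⟧     = ℕ → Raw
⟦ σ ⇒ τ ⟧ = ⟦ σ ⟧ → ⟦ τ ⟧

-- Extensional equality as a logical relation; it stands in for function extensionality.
Eqv : ∀ σ → ⟦ σ ⟧ → ⟦ σ ⟧ → Set
Eqv o       f g = ∀ n → f n ≡ g n
Eqv (σ ⇒ τ) f g = ∀ a b → Eqv σ a b → Eqv τ (f a) (g b)

Eqv-sym : ∀ σ {a b} → Eqv σ a b → Eqv σ b a
Eqv-sym o       p n     = sym (p n)
Eqv-sym (σ ⇒ τ) p a b r = Eqv-sym τ (p b a (Eqv-sym σ r))

Eqv-trans : ∀ σ {a b c} → Eqv σ a b → Eqv σ b c → Eqv σ a c
Eqv-trans o       p q n     = trans (p n) (q n)
Eqv-trans (σ ⇒ τ) p q a b r = Eqv-trans τ (p a b r) (q b b (Eqv-trans σ (Eqv-sym σ r) r))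

Eqv-reflˡ : ∀ σ {a b} → Eqv σ a b → Eqv σ a a
Eqv-reflˡ σ r = Eqv-trans σ r (Eqv-sym σ r)

Env : Ctx → Set
Env Γ = ∀ {σ} → Γ ∋ σ → ⟦ σ ⟧

EnvEqv : ∀ {Γ} → Env Γ → Env Γ → Set
EnvEqv {Γ} ρ ρ′ = ∀ {σ} (x : Γ ∋ σ) → Eqv σ (ρ x) (ρ′ x)

EnvEqv-sym : ∀ {Γ} {ρ ρ′ : Env Γ} → EnvEqv ρ ρ′ → EnvEqv ρ′ ρ
EnvEqv-sym e x = Eqv-sym _ (e x)

EnvEqv-reflʳ : ∀ {Γ} {ρ ρ′ : Env Γ} → EnvEqv ρ ρ′ → EnvEqv ρ′ ρ′
EnvEqv-reflʳ e x = Eqv-reflˡ _ (Eqv-sym _ (e x))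

infixr 5 _∷ₑ_
_∷ₑ_ : ∀ {Γ σ} → ⟦ σ ⟧ → Env Γ → Env (σ ∷ Γ)
(a ∷ₑ ρ) here      = a
(a ∷ₑ ρ) (there x) = ρ x

∷ₑ-Eqv : ∀ {Γ σ} {a b : ⟦ σ ⟧} {ρ ρ′ : Env Γ} → Eqv σ a b → EnvEqv ρ ρ′ →
         EnvEqv (a ∷ₑ ρ) (b ∷ₑ ρ′)
∷ₑ-Eqv r e here      = r
∷ₑ-Eqv r e (there x) = e x

eval : ∀ {Γ σ} → TmΩ Γ σ → Env Γ → ⟦ σ ⟧
eval (var x)    ρ = ρ x
eval (lam M)    ρ = λ a → eval M (a ∷ₑ ρ)
eval (app M N)  ρ = eval M ρ (eval N ρ)
eval (con refl) ρ = λ _ → rΩ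

eval-cong : ∀ {Γ σ} (M : TmΩ Γ σ) {ρ ρ′ : Env Γ} → EnvEqv ρ ρ′ → Eqv σ (eval M ρ) (eval M ρ′)
eval-cong (var x)    e       = e x
eval-cong (lam M)    e a b r = eval-cong M (∷ₑ-Eqv r e)
eval-cong (app M N)  e       = eval-cong M e _ _ (eval-cong N e)
eval-cong (con refl) e n     = refl

eval-rename : ∀ {Γ Δ σ} (r : Ren Γ Δ) (M : TmΩ Γ σ) {ρ : Env Δ} {ρ′ : Env Γ} →
              (∀ {τ} (x : Γ ∋ τ) → Eqv τ (ρ (r x)) (ρ′ x)) →
              Eqv σ (eval (rename r M) ρ) (eval M ρ′)
eval-rename r (var x)    e       = e x
eval-rename r (lam M)    e a b q = eval-rename (extR r) M (λ { here → q ; (there x) → e x })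
eval-rename r (app M N)  e       = eval-rename r M e _ _ (eval-rename r N e)
eval-rename r (con refl) e n     = refl

eval-subst : ∀ {Γ Δ σ} (s : Sub ConstΩ Γ Δ) (M : TmΩ Γ σ) {ρ : Env Δ} {ρ′ : Env Γ} →
             EnvEqv ρ ρ → (∀ {τ} (x : Γ ∋ τ) → Eqv τ (eval (s x) ρ) (ρ′ x)) →
             Eqv σ (eval (subst s M) ρ) (eval M ρ′)
eval-subst s (var x)    ρρ e = e x
eval-subst s (lam M) {ρ} ρρ e a b q = eval-subst (extS s) M (∷ₑ-Eqv (Eqv-reflˡ _ q) ρρ)
  (λ { here      → q
     ; (there x) → Eqv-trans _ (eval-rename there (s x) {a ∷ₑ ρ} {ρ} ρρ) (e x) })
eval-subst s (app M N)  ρρ e = eval-subst s M ρρ e _ _ (eval-subst s N ρρ e)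
eval-subst s (con refl) ρρ e n = refl

eval-sound : ∀ {Γ σ} {M N : TmΩ Γ σ} → ConstΩ ⊢ M ≈ N →
             ∀ {ρ ρ′ : Env Γ} → EnvEqv ρ ρ′ → Eqv σ (eval M ρ) (eval N ρ′)
eval-sound {M = M} ≈refl e       = eval-cong M e
eval-sound (≈sym p)     e        = Eqv-sym _ (eval-sound p (EnvEqv-sym e))
eval-sound (≈trans p q) e        = Eqv-trans _ (eval-sound p e) (eval-sound q (EnvEqv-reflʳ e))
eval-sound (≈lam p)     e a b r  = eval-sound p (∷ₑ-Eqv r e)
eval-sound (≈app p q)   e        = eval-sound p e _ _ (eval-sound q e)
eval-sound (≈β M N)     e rewrite []-as-subst M N =
  Eqv-trans _ (eval-cong M (∷ₑ-Eqv (eval-cong N e) e))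
    (Eqv-sym _ (eval-subst (var ▸ N) M (EnvEqv-reflʳ e)
                  (λ { here → eval-cong N (EnvEqv-reflʳ e) ; (there x) → EnvEqv-reflʳ e x })))
eval-sound (≈η M) {ρ} e a b r    = eval-rename there M {a ∷ₑ ρ} e a b r

-- Read-back and printing

↓ : ∀ σ → ⟦ σ ⟧ → ℕ → Raw
↑ : ∀ σ → (ℕ → Raw) → ⟦ σ ⟧
↓ o       f n = f n
↓ (σ ⇒ τ) f n = rlam (↓ τ (f (↑ σ (λ _ → rvar n))) (suc n))
↑ o       r   = r
↑ (σ ⇒ τ) r a = ↑ τ (λ n → rapp (r n) (↓ σ a n))

↓-cong : ∀ σ {a b} → Eqv σ a b → ∀ n → ↓ σ a n ≡ ↓ σ b n
↑-cong : ∀ σ {r r′ : ℕ → Raw} → (∀ n → r n ≡ r′ n) → Eqv σ (↑ σ r) (↑ σ r′)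
↓-cong o       p n       = p n
↓-cong (σ ⇒ τ) p n       = cong rlam (↓-cong τ (p _ _ (↑-cong σ (λ _ → refl))) (suc n))
↑-cong o       p         = p
↑-cong (σ ⇒ τ) p a b q   = ↑-cong τ (λ n → cong₂ rapp (p n) (↓-cong σ q n))

ΩV : ∀ σ → ⟦ σ ⟧
ΩV o       = λ _ → rΩ
ΩV (σ ⇒ τ) = λ _ → ΩV τ

eval-Ω̃ : ∀ {Γ} σ (ρ : Env Γ) → Eqv σ (eval (Ω̃ σ) ρ) (ΩV σ)
eval-Ω̃ o       ρ n       = refl
eval-Ω̃ (σ ⇒ τ) ρ a b r   = eval-Ω̃ τ (a ∷ₑ ρ)

-- Ω absorbs its arguments, as Ω̃ (σ ⇒ τ) applied to anything is Ω̃ τ.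
infixl 6 _·_
_·_ : Raw → Raw → Raw
rΩ         · s = rΩ
rvar k     · s = rapp (rvar k) s
rlam r     · s = rapp (rlam r) s
rapp r r′  · s = rapp (rapp r r′) s

·-≢rΩ : ∀ {r} s → r ≢ rΩ → r · s ≡ rapp r s
·-≢rΩ {rΩ}       s r≢Ω = ⊥-elim (r≢Ω refl)
·-≢rΩ {rvar _}   s r≢Ω = refl
·-≢rΩ {rlam _}   s r≢Ω = refl
·-≢rΩ {rapp _ _} s r≢Ω = refl

·-≢rvar : ∀ r s k → r · s ≢ rvar k
·-≢rvar rΩ         s k ()
·-≢rvar (rvar _)   s k ()
·-≢rvar (rlam _)   s k ()
·-≢rvar (rapp _ _) s k ()

·-≡rapp : ∀ r s a b → r · s ≡ rapp a b → r ≡ a × s ≡ b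
·-≡rapp rΩ         s a b ()
·-≡rapp (rvar _)   s a b refl = refl , refl
·-≡rapp (rlam _)   s a b refl = refl , refl
·-≡rapp (rapp _ _) s a b refl = refl , refl

Levels : Ctx → Set
Levels Γ = ∀ {σ} → Γ ∋ σ → ℕ

_∷ₗ_ : ∀ {Γ σ} → ℕ → Levels Γ → Levels (σ ∷ Γ)
(n ∷ₗ η) here      = n
(n ∷ₗ η) (there x) = η x

print : ∀ {Γ σ} → TmΩ⁺ Γ σ → Levels Γ → ℕ → Raw
print (var x)   η n = rvar (η x)
print (lam M)   η n = rlam (print M (n ∷ₗ η) (suc n))
print (app M N) η n = print M η n · print N η n
print (con _)   η n = rΩ

Generic : ∀ {Γ} → Env Γ → Levels Γ → Set
Generic {Γ} ρ η = ∀ {σ} (x : Γ ∋ σ) → Eqv σ (ρ x) (↑ σ (λ _ → rvar (η x)))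

Generic-∷ : ∀ {Γ σ} {ρ : Env Γ} {η : Levels Γ} n → Generic ρ η →
            Generic (↑ σ (λ _ → rvar n) ∷ₑ ρ) (n ∷ₗ η)
Generic-∷ {σ = σ} n g here      = ↑-cong σ (λ _ → refl)
Generic-∷         n g (there x) = g x

Generic⇒EnvEqv : ∀ {Γ} {ρ : Env Γ} {η : Levels Γ} → Generic ρ η → EnvEqv ρ ρ
Generic⇒EnvEqv g x = Eqv-reflˡ _ (g x)

data NeValue {Γ σ} (N : TmΩ⁺ Γ σ) (ρ : Env Γ) (η : Levels Γ) : Set where
  var-headed : (∀ n → print N η n ≢ rΩ) → Eqv σ (eval (tilde N) ρ) (↑ σ (print N η)) →
               NeValue N ρ η
  Ω-headed   : (∀ n → print N η n ≡ rΩ) → Eqv σ (eval (tilde N) ρ) (ΩV σ) →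
               NeValue N ρ η

↓-eval-tilde-nf : ∀ {Γ σ} {N : TmΩ⁺ Γ σ} → Nf N → ∀ {ρ : Env Γ} {η : Levels Γ} → Generic ρ η →
                  ∀ n → ↓ σ (eval (tilde N) ρ) n ≡ print N η n
eval-tilde-ne   : ∀ {Γ σ} {N : TmΩ⁺ Γ σ} → Ne N → ∀ {ρ : Env Γ} {η : Levels Γ} → Generic ρ η →
                  NeValue N ρ η
↓-eval-tilde-nf (nf-lam nM) g n = cong rlam (↓-eval-tilde-nf nM (Generic-∷ n g) (suc n))
↓-eval-tilde-nf (nf-ne nN) g n with eval-tilde-ne nN g
... | var-headed _ e = e n
... | Ω-headed  Ω≡ e = trans (e n) (sym (Ω≡ n))
eval-tilde-ne (ne-var x) g = var-headed (λ n ()) (g x)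
eval-tilde-ne (ne-con c) {ρ} g = Ω-headed (λ n → refl) (eval-Ω̃ _ ρ)
eval-tilde-ne (ne-app {τ = τ} {M = M} {N = A} nM nA) {ρ} {η} g with eval-tilde-ne nM g
... | var-headed M≢Ω e = var-headed
  (λ n → ≡.subst (_≢ rΩ) (sym (·-≢rΩ (print A η n) (M≢Ω n))) (λ ()))
  (Eqv-trans τ (e _ _ (eval-cong (tilde A) (Generic⇒EnvEqv g)))
     (↑-cong τ (λ n → trans (cong (rapp (print M η n)) (↓-eval-tilde-nf nA g n))
                            (sym (·-≢rΩ (print A η n) (M≢Ω n))))))
... | Ω-headed M≡Ω e = Ω-headed
  (λ n → cong (_· print A η n) (M≡Ω n))
  (e _ _ (eval-cong (tilde A) (Generic⇒EnvEqv g)))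

-- Injectivity of printing

record Fresh {Γ} (η : Levels Γ) (n : ℕ) : Set where
  field
    below     : ∀ {σ} (x : Γ ∋ σ) → η x < n
    injective : ∀ {σ τ} (x : Γ ∋ σ) (y : Γ ∋ τ) → η x ≡ η y → _≡_ {A = ∃ (Γ ∋_)} (σ , x) (τ , y)
open Fresh

Fresh-∷ : ∀ {Γ σ} {η : Levels Γ} {n} → Fresh η n → Fresh (_∷ₗ_ {σ = σ} n η) (suc n)
below     (Fresh-∷ f) here                  = n<1+n _
below     (Fresh-∷ f) (there x)             = m<n⇒m<1+n (below f x)
injective (Fresh-∷ f) here      here      p = refl
injective (Fresh-∷ f) here      (there y) p = ⊥-elim (<-irrefl (sym p) (below f y))
injective (Fresh-∷ f) (there x) here      p = ⊥-elim (<-irrefl p (below f x))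
injective (Fresh-∷ f) (there x) (there y) p with injective f x y p
... | refl = refl

print-ne-≢rΩ : ∀ {Γ σ} {K : TmΩ⁺ Γ σ} → Ne K → NoΩ K → ∀ (η : Levels Γ) n → print K η n ≢ rΩ
print-ne-≢rΩ (ne-var x) _ η n ()
print-ne-≢rΩ (ne-app {N = A} nK nA) (noΩ-app noK noA) η n
  rewrite ·-≢rΩ (print A η n) (print-ne-≢rΩ nK noK η n) = λ ()

print-injective-nf : ∀ {Γ σ} {N K : TmΩ⁺ Γ σ} → Nf N → Nf K → NoΩ K →
                     ∀ {η : Levels Γ} {n} → Fresh η n → print N η n ≡ print K η n → N ≡ K
print-injective-ne : ∀ {Γ σ τ} {N : TmΩ⁺ Γ σ} {K : TmΩ⁺ Γ τ} → Ne N → Ne K → NoΩ K →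
                     ∀ {η : Levels Γ} {n} → Fresh η n → print N η n ≡ print K η n →
                     _≡_ {A = ∃ (TmΩ⁺ Γ)} (σ , N) (τ , K)
print-injective-nf (nf-lam nN) (nf-lam nK) (noΩ-lam noK) f p =
  cong lam (print-injective-nf nN nK noK (Fresh-∷ f) (rlam-injective p))
  where rlam-injective : ∀ {r s} → rlam r ≡ rlam s → r ≡ s
        rlam-injective refl = refl
print-injective-nf (nf-ne nN) (nf-ne nK) noK f p with print-injective-ne nN nK noK f p
... | refl = refl
print-injective-ne (ne-var x) (ne-var y) _ f p with injective f x y (rvar-injective p)
  where rvar-injective : ∀ {k l} → rvar k ≡ rvar l → k ≡ l
        rvar-injective refl = refl
... | refl = refl
print-injective-ne (ne-var x) (ne-app nK nA) _ f p = ⊥-elim (·-≢rvar _ _ _ (sym p))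
print-injective-ne (ne-con c) nK noK {η} {n} f p = ⊥-elim (print-ne-≢rΩ nK noK η n (sym p))
print-injective-ne (ne-app nN nA) (ne-var y) _ f p = ⊥-elim (·-≢rvar _ _ _ p)
print-injective-ne (ne-app {N = A} nN nA) (ne-app {N = B} nK nB) (noΩ-app noK noB) {η} {n} f p
  with ·-≡rapp _ _ _ _ (trans p (·-≢rΩ (print B η n) (print-ne-≢rΩ nK noK η n)))
... | M≡ , A≡ with print-injective-ne nN nK noK f M≡
... | refl rewrite print-injective-nf nA nB noB f A≡ = refl

index : ∀ {Γ σ} → Γ ∋ σ → ℕ
index here      = zero
index (there x) = suc (index x)

Fresh-index : ∀ {Γ} → Fresh (index {Γ}) (length Γ)
below     Fresh-index here      = s≤s z≤n
below     Fresh-index (there x) = s≤s (below Fresh-index x)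
injective Fresh-index here      here      p = refl
injective Fresh-index (there x) (there y) p with injective Fresh-index x y (suc-injective p)
... | refl = refl

indexEnv : ∀ {Γ} → Env Γ
indexEnv {σ = σ} x = ↑ σ (λ _ → rvar (index x))

Generic-indexEnv : ∀ {Γ} → Generic {Γ} indexEnv index
Generic-indexEnv {σ = σ} x = ↑-cong σ (λ _ → refl)

tilde-≈-injective : ∀ {Γ σ} {N K : TmΩ⁺ Γ σ} → Nf N → ProperNf K →
                    ConstΩ ⊢ tilde N ≈ tilde K → N ≡ K
tilde-≈-injective {Γ} {σ} {N} {K} nN (nK , noK) p =
  print-injective-nf nN nK noK Fresh-index (begin
    print N index n                ≡⟨ sym (↓-eval-tilde-nf nN Generic-indexEnv n) ⟩
    ↓ σ (eval (tilde N) indexEnv) n ≡⟨ ↓-cong σ (eval-sound p (Generic⇒EnvEqv Generic-indexEnv)) n ⟩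
    ↓ σ (eval (tilde K) indexEnv) n ≡⟨ ↓-eval-tilde-nf nK Generic-indexEnv n ⟩
    print K index n                ∎)
  where
    open ≡.≡-Reasoning
    n : ℕ
    n = length Γ

lemma6 : ∀ {σ} (M : TmΩ⁺ [] σ) (K : TmΩ⁺ [] σ) → ProperNf K →
    ((ConstΩ⁺ ⊢ M ≈ K) → (ConstΩ ⊢ tilde M ≈ tilde K)) ×
    ((ConstΩ ⊢ tilde M ≈ tilde K) → (ConstΩ⁺ ⊢ M ≈ K))
lemma6 M K properK = tilde-≈ , backward
  where
    backward : ConstΩ ⊢ tilde M ≈ tilde K → ConstΩ⁺ ⊢ M ≈ K
    backward p with normalise M
    ... | N , nN , M≈N =
      ≈trans M≈N (≡⇒≈ (tilde-≈-injective nN properK (≈trans (≈sym (tilde-≈ M≈N)) p)))
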